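{- Let $f:\mathbb{N}\to\mathbb{N}$ be increasing with $f(0)>0$, let $\tau$ be a type, $k\in\tau$, $t\in\mathbb{N}$, and let $x$ be an element of a summand $\mathbb{N}^k$ of $\mathbb{N}^\tau$ with $\|x\|_\infty\le f(t)-1$. Then $\mathbb{N}^\tau/x\hookrightarrow\mathbb{N}^{\tau_{\langle k,t\rangle}}$.
   Context: A type is a finite multiset of naturals; $\mathbb{N}^\tau$ is the disjoint union of $\mathbb{N}^{m}$ for $m\in\tau$ (with multiplicity), with $x\le y$ iff they lie in the same summand and $x\le y$ coordinatewise. $N_k(t)=k\cdot(f(t)-1)$ and $\tau_{\langle k,t\rangle}=\tau-\{k\}+N_k(t)\times\{k-1\}$ (multiset operations; for $k=0$, $\tau-\{0\}$). For $a\in A$, $A/a=\{y\in A\mid a\not\le y\}$. $\|x\|_\infty$ is the maximum coordinate (0 for the empty tuple). A map $h:A_1\to A_2$ between such quasi-orders is a strong reflection, written $A_1\hookrightarrow A_2$, if $h(a)\le h(b)$ implies $a\le b$ and $\|h(x)\|_\infty\le\|x\|_\infty$ for all $x$. -}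

module Defs where

open import Data.Nat using (ℕ; zero; suc; _≤_; _<_; _∸_; _*_; _⊔_)
open import Data.List using (List; _∷_; []; _++_; replicate)
open import Data.List.Relation.Unary.Any using (Any; here; there; _─_)
open import Data.Vec using (Vec; foldr)
open import Data.Vec.Relation.Binary.Pointwise.Inductive using (Pointwise)
open import Data.Product using (Σ; _×_; Σ-syntax; _,_; proj₁)
open import Relation.Nullary using (¬_)
open import Relation.Binary.PropositionalEquality using (_≡_)

-- A type: a finite multiset of naturals, represented by a list
-- (the order of the list is irrelevant for all notions below).
Ty : Set
Ty = List ℕ

-- ℕ^τ : disjoint union of ℕ^m for m ∈ τ (with multiplicity).
-- An element is a position in τ together with a vector of that dimension.
Nτ : Ty → Set
Nτ τ = Any (λ m → Vec ℕ m) τ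

dim : ∀ {τ} → Nτ τ → ℕ
dim (here {m} _) = m
dim (there x) = dim x

data _≤τ_ : ∀ {τ} → Nτ τ → Nτ τ → Set where
  here≤  : ∀ {m τ} {u v : Vec ℕ m} → Pointwise _≤_ u v →
           _≤τ_ {m ∷ τ} (here u) (here v)
  there≤ : ∀ {m τ} {x y : Nτ τ} → x ≤τ y → _≤τ_ {m ∷ τ} (there x) (there y)

-- infinity norm (0 for the empty tuple)
∥_∥v : ∀ {m} → Vec ℕ m → ℕ
∥ v ∥v = foldr _ _⊔_ 0 v

∥_∥ : ∀ {τ} → Nτ τ → ℕ
∥ here v ∥ = ∥ v ∥v
∥ there x ∥ = ∥ x ∥

Quot : (τ : Ty) → Nτ τ → Set
Quot τ a = Σ[ y ∈ Nτ τ ] ¬ (a ≤τ y)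

_≤Q_ : ∀ {τ a} → Quot τ a → Quot τ a → Set
(y , _) ≤Q (z , _) = y ≤τ z

∥_∥Q : ∀ {τ a} → Quot τ a → ℕ
∥ (y , _) ∥Q = ∥ y ∥

StrongReflection : (A₁ : Set) → (A₁ → A₁ → Set) → (A₁ → ℕ) →
                   (A₂ : Set) → (A₂ → A₂ → Set) → (A₂ → ℕ) → Set
StrongReflection A₁ _≤₁_ n₁ A₂ _≤₂_ n₂ =
  Σ[ h ∈ (A₁ → A₂) ] ((∀ a b → h a ≤₂ h b → a ≤₁ b) × (∀ a → n₂ (h a) ≤ n₁ a))

Nk : (ℕ → ℕ) → ℕ → ℕ → ℕ
Nk f k t = k * (f t ∸ 1)

-- τ_{⟨k,t⟩} where the removed copy of k is the summand containing x
-- (dim x ≡ k); as multisets this is τ - {k} + N_k(t) × {k-1}.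
derive : (f : ℕ → ℕ) (τ : Ty) (x : Nτ τ) (t : ℕ) → Ty
derive f τ x t = (τ ─ x) ++ replicate (Nk f (dim x) t) (dim x ∸ 1)

Increasing : (ℕ → ℕ) → Set
Increasing f = ∀ {m n} → m ≤ n → f m ≤ f n

module Submission where

-- Write F = f(t) - 1, so ∥x∥ ≤ F.  Let y ∈ ℕ^τ with x ≰ y.  If y lies in a
-- different summand than x it is sent to the same summand of τ - {k}.  If y
-- lies in the summand ℕ^k of x, then x ≰ y coordinatewise yields a position
-- i < k with y_i < x_i ≤ F; deleting coordinate i from y gives a vector of
-- ℕ^{k-1}, which we put into the copy of ℕ^{k-1} indexed by the pair (i, y_i),
-- one of k · F = N_k(t) copies.  The pair (i, y_i) together with the remaining
-- coordinates determines y, so the map reflects the order, and deleting a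
-- coordinate does not increase the maximum norm.

open import Defs
open import Data.Nat using (ℕ; suc; _≤_; _<_; _∸_; _*_; _≤?_)
open import Data.Nat.Properties using (≤-refl; ≤-trans; m≤m⊔n; m≤n⊔m; ⊔-monoʳ-≤; ≰⇒>; <-≤-trans)
open import Data.Fin using (Fin; combine; fromℕ<; toℕ) renaming (zero to fzero; suc to fsuc)
open import Data.Fin.Properties using (combine-injectiveˡ; combine-injectiveʳ; toℕ-fromℕ<)
open import Data.List using (List; _++_; replicate) renaming ([] to []ˡ; _∷_ to _∷ˡ_)
open import Data.List.Relation.Unary.Any using (here; there; _─_)
open import Data.List.Relation.Unary.Any.Properties using (++⁺ˡ; ++⁺ʳ)
open import Data.Vec using (Vec; _∷_; []; insertAt)
open import Data.Vec.Relation.Binary.Pointwise.Inductive using (Pointwise; _∷_; [])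
open import Data.Product using (_×_; _,_)
open import Data.Empty using (⊥-elim)
open import Relation.Nullary using (¬_; yes; no)
open import Relation.Binary.PropositionalEquality using (_≡_; refl; sym; cong; subst)

_≤v_ : ∀ {m} → Vec ℕ m → Vec ℕ m → Set
_≤v_ = Pointwise _≤_

insertAt-mono : ∀ {m} {r r′ : Vec ℕ m} (i : Fin (suc m)) (a : ℕ) →
                r ≤v r′ → insertAt r i a ≤v insertAt r′ i a
insertAt-mono fzero    a r≤r′          = ≤-refl ∷ r≤r′
insertAt-mono (fsuc i) a (b≤b′ ∷ r≤r′) = b≤b′ ∷ insertAt-mono i a r≤r′

norm-insertAt : ∀ {m} (r : Vec ℕ m) (i : Fin (suc m)) (a : ℕ) →
                ∥ r ∥v ≤ ∥ insertAt r i a ∥v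
norm-insertAt r       fzero    a = m≤n⊔m a ∥ r ∥v
norm-insertAt (b ∷ r) (fsuc i) a = ⊔-monoʳ-≤ b (norm-insertAt r i a)

module _ (F : ℕ) where

  record Escape {m : ℕ} (v : Vec ℕ (suc m)) : Set where
    constructor escapeAt
    field
      position : Fin (suc m)
      value    : Fin F
      rest     : Vec ℕ m
      splits   : v ≡ insertAt rest position (toℕ value)

  escape-∷ : ∀ {m} (b : ℕ) {v : Vec ℕ (suc m)} → Escape v → Escape (b ∷ v)
  escape-∷ b (escapeAt i a r refl) = escapeAt (fsuc i) a (b ∷ r) refl

  escape : ∀ {m} (u v : Vec ℕ (suc m)) → ¬ u ≤v v → ∥ u ∥v ≤ F → Escape v
  escape (a ∷ u) (b ∷ v) u≰v ∥u∥≤F with a ≤? b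
  ... | no a≰b = escapeAt fzero (fromℕ< b<F) v (cong (λ c → c ∷ v) (sym (toℕ-fromℕ< b<F)))
    where b<F : b < F
          b<F = <-≤-trans (≰⇒> a≰b) (≤-trans (m≤m⊔n a ∥ u ∥v) ∥u∥≤F)
  escape (a ∷ []) (b ∷ []) u≰v _ | yes a≤b = ⊥-elim (u≰v (a≤b ∷ []))
  escape (a ∷ u@(_ ∷ _)) (b ∷ v@(_ ∷ _)) u≰v ∥u∥≤F | yes a≤b =
    escape-∷ b (escape u v (λ u≤v → u≰v (a≤b ∷ u≤v)) (≤-trans (m≤n⊔m a ∥ u ∥v) ∥u∥≤F))

copy : ∀ {n d} → Fin n → Vec ℕ d → Nτ (replicate n d)
copy fzero    w = here w
copy (fsuc i) w = there (copy i w)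

copy-reflects : ∀ {n d} {i j : Fin n} {w w′ : Vec ℕ d} →
                copy i w ≤τ copy j w′ → i ≡ j × w ≤v w′
copy-reflects {i = fzero}  {fzero}  (here≤ w≤w′) = refl , w≤w′
copy-reflects {i = fsuc i} {fsuc j} (there≤ p) with copy-reflects p
... | refl , w≤w′ = refl , w≤w′

norm-copy : ∀ {n d} (i : Fin n) (w : Vec ℕ d) → ∥ copy i w ∥ ≡ ∥ w ∥v
norm-copy fzero    w = refl
norm-copy (fsuc i) w = norm-copy i w

++⁺ˡ-reflects : ∀ {σ ρ} {y y′ : Nτ σ} → ++⁺ˡ {ys = ρ} y ≤τ ++⁺ˡ y′ → y ≤τ y′
++⁺ˡ-reflects {y = here _}  {here _}  (here≤ p)  = here≤ p
++⁺ˡ-reflects {y = there _} {there _} (there≤ p) = there≤ (++⁺ˡ-reflects p)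

++⁺ʳ-reflects : ∀ σ {ρ} {z z′ : Nτ ρ} → ++⁺ʳ σ z ≤τ ++⁺ʳ σ z′ → z ≤τ z′
++⁺ʳ-reflects []ˡ      p          = p
++⁺ʳ-reflects (_ ∷ˡ σ) (there≤ p) = ++⁺ʳ-reflects σ p

++⁺ˡ≰++⁺ʳ : ∀ σ {ρ} (y : Nτ σ) (z : Nτ ρ) → ¬ (++⁺ˡ y ≤τ ++⁺ʳ σ z)
++⁺ˡ≰++⁺ʳ (_ ∷ˡ σ) (here _)  z ()
++⁺ˡ≰++⁺ʳ (_ ∷ˡ σ) (there y) z (there≤ p) = ++⁺ˡ≰++⁺ʳ σ y z p

++⁺ʳ≰++⁺ˡ : ∀ σ {ρ} (y : Nτ σ) (z : Nτ ρ) → ¬ (++⁺ʳ σ z ≤τ ++⁺ˡ y)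
++⁺ʳ≰++⁺ˡ (_ ∷ˡ σ) (here _)  z ()
++⁺ʳ≰++⁺ˡ (_ ∷ˡ σ) (there y) z (there≤ p) = ++⁺ʳ≰++⁺ˡ σ y z p

norm-++⁺ˡ : ∀ {σ ρ} (y : Nτ σ) → ∥ ++⁺ˡ {ys = ρ} y ∥ ≡ ∥ y ∥
norm-++⁺ˡ (here _)  = refl
norm-++⁺ˡ (there y) = norm-++⁺ˡ y

norm-++⁺ʳ : ∀ σ {ρ} (z : Nτ ρ) → ∥ ++⁺ʳ σ z ∥ ≡ ∥ z ∥
norm-++⁺ʳ []ˡ      z = refl
norm-++⁺ʳ (_ ∷ˡ σ) z = norm-++⁺ʳ σ z

module Reflection (F : ℕ) where

  Copies : ℕ → List ℕ
  Copies m = replicate (m * F) (m ∸ 1)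

  embedEscape : ∀ {m} {v : Vec ℕ (suc m)} → Escape F v → Nτ (Copies (suc m))
  embedEscape (escapeAt i a r _) = copy (combine i a) r

  -- The pair (i, a) and the rest r determine v, hence the order is reflected.
  embedEscape-reflects : ∀ {m} {v v′ : Vec ℕ (suc m)} (e : Escape F v) (e′ : Escape F v′) →
                         embedEscape e ≤τ embedEscape e′ → v ≤v v′
  embedEscape-reflects (escapeAt i a r refl) (escapeAt i′ a′ r′ refl) p
    with copy-reflects p
  ... | same , r≤r′
    with combine-injectiveˡ i a i′ a′ same | combine-injectiveʳ i a i′ a′ same
  ... | refl | refl = insertAt-mono i (toℕ a) r≤r′

  norm-embedEscape : ∀ {m} {v : Vec ℕ (suc m)} (e : Escape F v) → ∥ embedEscape e ∥ ≤ ∥ v ∥v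
  norm-embedEscape (escapeAt i a r refl) =
    subst (_≤ ∥ insertAt r i (toℕ a) ∥v) (sym (norm-copy (combine i a) r)) (norm-insertAt r i (toℕ a))

  reduce : ∀ {m} (u v : Vec ℕ m) → ¬ u ≤v v → ∥ u ∥v ≤ F → Nτ (Copies m)
  reduce []      []      u≰v _     = ⊥-elim (u≰v [])
  reduce (a ∷ u) v       u≰v ∥u∥≤F = embedEscape (escape F (a ∷ u) v u≰v ∥u∥≤F)

  reduce-reflects : ∀ {m} (u v v′ : Vec ℕ m) u≰v u≰v′ ∥u∥≤F →
                    reduce u v u≰v ∥u∥≤F ≤τ reduce u v′ u≰v′ ∥u∥≤F → v ≤v v′
  reduce-reflects []      []  []   u≰v _ _ _ = ⊥-elim (u≰v [])
  reduce-reflects (a ∷ u) v   v′   u≰v u≰v′ ∥u∥≤F =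
    embedEscape-reflects (escape F (a ∷ u) v u≰v ∥u∥≤F) (escape F (a ∷ u) v′ u≰v′ ∥u∥≤F)

  norm-reduce : ∀ {m} (u v : Vec ℕ m) u≰v ∥u∥≤F → ∥ reduce u v u≰v ∥u∥≤F ∥ ≤ ∥ v ∥v
  norm-reduce []      []  u≰v _     = ⊥-elim (u≰v [])
  norm-reduce (a ∷ u) v   u≰v ∥u∥≤F = norm-embedEscape (escape F (a ∷ u) v u≰v ∥u∥≤F)

  reflect : ∀ {τ} (x y : Nτ τ) → ¬ x ≤τ y → ∥ x ∥ ≤ F → Nτ ((τ ─ x) ++ Copies (dim x))
  reflect {_ ∷ˡ τ} (here u)  (here v)  x≰y ∥x∥≤F = ++⁺ʳ τ (reduce u v (λ p → x≰y (here≤ p)) ∥x∥≤F)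
  reflect         (here u)  (there y) _   _     = ++⁺ˡ y
  reflect         (there x) (here v)  _   _     = here v
  reflect         (there x) (there y) x≰y ∥x∥≤F = there (reflect x y (λ p → x≰y (there≤ p)) ∥x∥≤F)

  reflect-reflects : ∀ {τ} (x y y′ : Nτ τ) x≰y x≰y′ ∥x∥≤F →
                     reflect x y x≰y ∥x∥≤F ≤τ reflect x y′ x≰y′ ∥x∥≤F → y ≤τ y′
  reflect-reflects {_ ∷ˡ τ} (here u) (here v) (here v′) _ _ ∥x∥≤F p =
    here≤ (reduce-reflects u v v′ _ _ ∥x∥≤F (++⁺ʳ-reflects τ p))
  reflect-reflects {_ ∷ˡ τ} (here u) (here v) (there y′) _ _ _ p = ⊥-elim (++⁺ʳ≰++⁺ˡ τ y′ _ p)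
  reflect-reflects {_ ∷ˡ τ} (here u) (there y) (here v′) _ _ _ p = ⊥-elim (++⁺ˡ≰++⁺ʳ τ y _ p)
  reflect-reflects (here u)  (there y) (there y′) _ _ _     p = there≤ (++⁺ˡ-reflects p)
  reflect-reflects (there x) (here v)  (here v′)  _ _ _     (here≤ p) = here≤ p
  reflect-reflects (there x) (there y) (there y′) _ _ ∥x∥≤F (there≤ p) =
    there≤ (reflect-reflects x y y′ _ _ ∥x∥≤F p)

  norm-reflect : ∀ {τ} (x y : Nτ τ) x≰y ∥x∥≤F → ∥ reflect x y x≰y ∥x∥≤F ∥ ≤ ∥ y ∥
  norm-reflect {_ ∷ˡ τ} (here u) (here v) _ ∥x∥≤F =
    subst (_≤ ∥ v ∥v) (sym (norm-++⁺ʳ τ _)) (norm-reduce u v _ ∥x∥≤F)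
  norm-reflect {_ ∷ˡ τ} (here {m} u) (there y) _ _ =
    subst (_≤ ∥ y ∥) (sym (norm-++⁺ˡ {ρ = Copies m} y)) ≤-refl
  norm-reflect (there x) (here v)  _ _     = ≤-refl
  norm-reflect (there x) (there y) _ ∥x∥≤F = norm-reflect x y _ ∥x∥≤F

-- With F = f(t) - 1 the target (τ - x) ++ Copies (dim x) is exactly τ⟨k,t⟩.
lemma3 : (f : ℕ → ℕ) → Increasing f → 0 < f 0 →
         (τ : Ty) (k : ℕ) (t : ℕ) (x : Nτ τ) → dim x ≡ k →
         ∥ x ∥ ≤ f t ∸ 1 →
         StrongReflection (Quot τ x) _≤Q_ ∥_∥Q
                          (Nτ (derive f τ x t)) _≤τ_ ∥_∥
lemma3 f _ _ τ _ t x _ ∥x∥≤F =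
    (λ { (y , x≰y) → reflect x y x≰y ∥x∥≤F })
  , (λ { (y , x≰y) (y′ , x≰y′) p → reflect-reflects x y y′ x≰y x≰y′ ∥x∥≤F p })
  , (λ { (y , x≰y) → norm-reflect x y x≰y ∥x∥≤F })
  where open Reflection (f t ∸ 1)
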